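{- Let $G$ be a graph with a partition of its vertex set into independent sets $V_1,V_2,\ldots,V_k$ such that $\phi(V_j,V_i)=\emptyset$ whenever $j>i$. Let $E$ be a set of edges of $G$ that is maximal (with respect to inclusion) subject to the following two conditions: (1) if $e=\{u,r\}\in E$ with $u\in V_i$ and $r\in V_j$, then $e$ is an isolated edge in the induced subgraph $G[V_i\cup V_j]$ (i.e., $\{u,r\}$ forms a connected component of $G[V_i\cup V_j]$); (2) if $e_1,e_2\in E$ share a common endpoint, then there is no triangle in $G$ containing both $e_1$ and $e_2$. Then $A=V_1V_1\cup V_2V_2\cup\cdots\cup V_kV_k\cup E$ is a maximal independent set in $T_2(G)$ (where each edge of $E$ is regarded as a $2$-subset of $V(G)$).
   Context: All graphs are finite and simple. The $2$-token graph $T_2(G)$ has as vertices the $2$-subsets of $V(G)$, two of them adjacent if their symmetric difference is an edge of $G$. For $A\subseteq V(G)$, $AA$ denotes the set of all 2-subsets of $A$. For disjoint independent sets $A,B$ of $G$, $\phi(A,B)=\{x\in A : B\cup\{x\} \text{ is an independent set of } G\}$. $G[W]$ denotes the subgraph induced by $W$. -}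

module Defs where

open import Data.Nat using (ℕ)
open import Data.Bool using (Bool; true; false; _∧_; _∨_)
open import Data.Fin using (Fin; _<_; _≟_)
open import Data.Product using (Σ; _×_; ∃; proj₁; proj₂)
open import Data.Sum using (_⊎_)
open import Relation.Nullary using (¬_)
open import Relation.Nullary.Decidable using (⌊_⌋)
open import Relation.Binary.PropositionalEquality using (_≡_; _≢_)

record Graph (n : ℕ) : Set where
  field
    adj    : Fin n → Fin n → Bool
    sym    : ∀ u v → adj u v ≡ adj v u
    irrefl : ∀ u → adj u u ≡ false
open Graph public

Edge : ∀ {n} → Graph n → Fin n → Fin n → Set
Edge G u v = adj G u v ≡ true

VSet : ℕ → Set
VSet n = Fin n → Bool

insert : ∀ {n} → Fin n → VSet n → VSet n
insert x B v = ⌊ v ≟ x ⌋ ∨ B v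

Independent : ∀ {n} → Graph n → VSet n → Set
Independent G S = ∀ u v → S u ≡ true → S v ≡ true → adj G u v ≡ false

φ : ∀ {n} → Graph n → VSet n → VSet n → Fin n → Set
φ G A B x = (A x ≡ true) × Independent G (insert x B)

φ-empty : ∀ {n} → Graph n → VSet n → VSet n → Set
φ-empty G A B = ∀ x → ¬ φ G A B x

-- 2-subsets {a,b} of Fin n, represented with a < b (vertices of T₂(G)).
Token2 : ℕ → Set
Token2 n = Σ (Fin n) λ a → Σ (Fin n) λ b → a < b

fst₂ : ∀ {n} → Token2 n → Fin n
fst₂ X = proj₁ X

snd₂ : ∀ {n} → Token2 n → Fin n
snd₂ X = proj₁ (proj₂ X)

_∈₂_ : ∀ {n} → Fin n → Token2 n → Set
x ∈₂ X = (x ≡ fst₂ X) ⊎ (x ≡ snd₂ X)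

-- Adjacency in T₂(G): symmetric difference of X and Y is an edge of G,
-- i.e. X = {u,v}, Y = {u,w} with u,v,w distinct and vw ∈ E(G).
T2Adj : ∀ {n} → Graph n → Token2 n → Token2 n → Set
T2Adj {n} G X Y = Σ (Fin n) λ u → Σ (Fin n) λ v → Σ (Fin n) λ w →
  (u ∈₂ X) × (v ∈₂ X) × (u ∈₂ Y) × (w ∈₂ Y) ×
  (u ≢ v) × (u ≢ w) × (v ≢ w) × Edge G v w

TSet : ℕ → Set
TSet n = Token2 n → Bool

_⊆ₜ_ : ∀ {n} → TSet n → TSet n → Set
S ⊆ₜ S' = ∀ X → S X ≡ true → S' X ≡ true

IndependentT2 : ∀ {n} → Graph n → TSet n → Set
IndependentT2 G S = ∀ X Y → S X ≡ true → S Y ≡ true → ¬ T2Adj G X Y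

MaximalIndependentT2 : ∀ {n} → Graph n → TSet n → Set
MaximalIndependentT2 G S =
  IndependentT2 G S × (∀ S' → IndependentT2 G S' → S ⊆ₜ S' → S' ⊆ₜ S)

-- A partition of V(G) into classes V₁,…,Vₖ given by a class map part : Fin n → Fin k.
Class : ∀ {n k} → (Fin n → Fin k) → Fin k → VSet n
Class part i v = ⌊ part v ≟ i ⌋

GoodPartition : ∀ {n k} → Graph n → (Fin n → Fin k) → Set
GoodPartition {n} G part =
  (∀ i → ∃ λ (v : Fin n) → part v ≡ i) ×
  (∀ i → Independent G (Class part i)) ×
  (∀ i j → i < j → φ-empty G (Class part j) (Class part i))

EdgeSet : ∀ {n} → Graph n → TSet n → Set
EdgeSet G E = ∀ X → E X ≡ true → Edge G (fst₂ X) (snd₂ X)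

Cond1 : ∀ {n k} → Graph n → (Fin n → Fin k) → TSet n → Set
Cond1 G part E = ∀ X → E X ≡ true → ∀ w →
  (part w ≡ part (fst₂ X) ⊎ part w ≡ part (snd₂ X)) →
  (Edge G (fst₂ X) w → w ≡ snd₂ X) × (Edge G (snd₂ X) w → w ≡ fst₂ X)

-- Condition (2): if e₁ = {x,y}, e₂ = {x,z} ∈ E share endpoint x (e₁ ≠ e₂, i.e. y ≠ z),
-- then no triangle of G contains both, i.e. yz is not an edge.
Cond2 : ∀ {n} → Graph n → TSet n → Set
Cond2 G E = ∀ e₁ e₂ x y z → E e₁ ≡ true → E e₂ ≡ true →
  x ∈₂ e₁ → y ∈₂ e₁ → x ∈₂ e₂ → z ∈₂ e₂ → x ≢ y → x ≢ z → y ≢ z →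
  adj G y z ≡ false

Admissible : ∀ {n k} → Graph n → (Fin n → Fin k) → TSet n → Set
Admissible G part E = EdgeSet G E × Cond1 G part E × Cond2 G E

MaximalAdmissible : ∀ {n k} → Graph n → (Fin n → Fin k) → TSet n → Set
MaximalAdmissible G part E =
  Admissible G part E × (∀ E' → Admissible G part E' → E ⊆ₜ E' → E' ⊆ₜ E)

Aset : ∀ {n k} → (Fin n → Fin k) → TSet n → TSet n
Aset part E X = ⌊ part (fst₂ X) ≟ part (snd₂ X) ⌋ ∨ E X

module Submission where

open import Defs
open import Data.Fin using (Fin; _<_; _≟_)
open import Data.Fin.Properties using (<-cmp; <-irrelevant; <⇒≢)
open import Data.Bool using (true; false; _∨_)
open import Data.Bool.Properties using (∨-zeroʳ; ¬-not; not-¬)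
open import Data.Product using (Σ; _×_; _,_; proj₁; proj₂)
open import Data.Sum using (_⊎_; inj₁; inj₂; swap)
open import Function using (_∘_)
open import Relation.Nullary using (¬_; Dec; yes; no; contradiction)
open import Relation.Nullary.Decidable using (⌊_⌋)
open import Relation.Binary using (DecidableEquality; tri<; tri≈; tri>)
open import Relation.Binary.PropositionalEquality as ≡
  using (_≡_; refl; _≢_; trans; cong; ≢-sym)

-- Two tokens of A are never adjacent in T₂(G): the classes are independent, an
-- edge of E is isolated in G[V_i ∪ V_j] by (1), and two edges of E sharing a
-- vertex span no triangle by (2).
-- For maximality let S ⊇ A be independent in T₂(G) and {a,b} ∈ S with a, b in
-- different classes. Since {x,c} ∈ S for every c ≠ x in the class of x ∈ {a,b},
-- the other vertex of {a,b} has no neighbour in that class except possibly x.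
-- If ab were a non-edge, with a ∈ V_i, b ∈ V_j, i < j, this puts b in φ(V_j,V_i).
-- So ab is an edge, isolated in G[V_i ∪ V_j]; E ∪ {ab} ⊆ S is independent in
-- T₂(G), which is condition (2), and maximality of E gives ab ∈ E.

⌊⌋-sound : ∀ {P : Set} (d : Dec P) → ⌊ d ⌋ ≡ true → P
⌊⌋-sound (yes p) _ = p

⌊⌋-complete : ∀ {P : Set} (d : Dec P) → P → ⌊ d ⌋ ≡ true
⌊⌋-complete (yes _) _ = refl
⌊⌋-complete (no ¬p) p = contradiction p ¬p

⌊⌋∨-elim : ∀ {P : Set} {b} (d : Dec P) → ⌊ d ⌋ ∨ b ≡ true → P ⊎ b ≡ true
⌊⌋∨-elim (yes p) _ = inj₁ p
⌊⌋∨-elim (no _) b≡true = inj₂ b≡true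

⌊⌋∨-introˡ : ∀ {P : Set} {b} (d : Dec P) → P → ⌊ d ⌋ ∨ b ≡ true
⌊⌋∨-introˡ d p rewrite ⌊⌋-complete d p = refl

⌊⌋∨-introʳ : ∀ {P : Set} {b} (d : Dec P) → b ≡ true → ⌊ d ⌋ ∨ b ≡ true
⌊⌋∨-introʳ d refl = ∨-zeroʳ ⌊ d ⌋

token-ext : ∀ {n} {X Y : Token2 n} → fst₂ X ≡ fst₂ Y → snd₂ X ≡ snd₂ Y → X ≡ Y
token-ext {X = a , b , p} {Y = _ , _ , q} refl refl = cong (λ r → a , b , r) (<-irrelevant p q)

_≟ₜ_ : ∀ {n} → DecidableEquality (Token2 n)
X ≟ₜ Y with fst₂ X ≟ fst₂ Y | snd₂ X ≟ snd₂ Y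
... | yes a≡ | yes b≡ = yes (token-ext a≡ b≡)
... | no a≢ | _ = no (a≢ ∘ cong fst₂)
... | yes _ | no b≢ = no (b≢ ∘ cong snd₂)

token : ∀ {n} {x y : Fin n} → x ≢ y → Σ (Token2 n) λ T → x ∈₂ T × y ∈₂ T
token {x = x} {y} x≢y with <-cmp x y
... | tri< x<y _ _ = (x , y , x<y) , inj₁ refl , inj₂ refl
... | tri≈ _ x≡y _ = contradiction x≡y x≢y
... | tri> _ _ y<x = (y , x , y<x) , inj₂ refl , inj₁ refl

insertₜ : ∀ {n} → Token2 n → TSet n → TSet n
insertₜ X E Y = ⌊ Y ≟ₜ X ⌋ ∨ E Y

insertₜ-all : ∀ {n} {X} {E : TSet n} (P : Token2 n → Set) →
  P X → (∀ Y → E Y ≡ true → P Y) → ∀ Y → insertₜ X E Y ≡ true → P Y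
insertₜ-all {X = X} P PX PE Y Y∈ with ⌊⌋∨-elim (Y ≟ₜ X) Y∈
... | inj₁ refl = PX
... | inj₂ Y∈E = PE Y Y∈E

module _ {n} (G : Graph n) where

  edge⇒≢ : ∀ {x y} → Edge G x y → x ≢ y
  edge⇒≢ {x} loop refl = not-¬ loop (irrefl G x)

  edge-sym : ∀ {x y} → Edge G x y → Edge G y x
  edge-sym {x} {y} xy = trans (Graph.sym G y x) xy

  nonedge-sym : ∀ {x y} → adj G x y ≡ false → adj G y x ≡ false
  nonedge-sym {x} {y} xy = trans (Graph.sym G y x) xy

  insert-independent : ∀ {x B} → Independent G B →
    (∀ v → B v ≡ true → adj G x v ≡ false) → Independent G (insert x B)
  insert-independent {x} B-ind x-B u v u∈ v∈ with ⌊⌋∨-elim (u ≟ x) u∈ | ⌊⌋∨-elim (v ≟ x) v∈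
  ... | inj₁ refl | inj₁ refl = irrefl G u
  ... | inj₁ refl | inj₂ v∈B = x-B v v∈B
  ... | inj₂ u∈B | inj₁ refl = nonedge-sym (x-B u u∈B)
  ... | inj₂ u∈B | inj₂ v∈B = B-ind u v u∈B v∈B

  independentT2-⊆ : ∀ {S S′} → IndependentT2 G S → S′ ⊆ₜ S → IndependentT2 G S′
  independentT2-⊆ S-ind S′⊆S X Y X∈ Y∈ = S-ind X Y (S′⊆S X X∈) (S′⊆S Y Y∈)

  independentT2⇒cond2 : ∀ {E} → IndependentT2 G E → Cond2 G E
  independentT2⇒cond2 E-ind e₁ e₂ x y z e₁∈ e₂∈ x∈₁ y∈₁ x∈₂ z∈₂ x≢y x≢z y≢z =
    ¬-not λ yz → E-ind e₁ e₂ e₁∈ e₂∈ (x , y , z , x∈₁ , y∈₁ , x∈₂ , z∈₂ , x≢y , x≢z , y≢z , yz)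

  module _ {k} (part : Fin n → Fin k) (classes-independent : ∀ i → Independent G (Class part i)) where

    same-class⇒nonadjacent : ∀ {x y} → part x ≡ part y → ¬ Edge G x y
    same-class⇒nonadjacent {x} {y} x~y xy = not-¬ xy
      (classes-independent (part y) x y (⌊⌋-complete (part x ≟ part y) x~y) (⌊⌋-complete (part y ≟ part y) refl))

    ∈₂-same-class : ∀ {x y} T → part (fst₂ T) ≡ part (snd₂ T) → x ∈₂ T → y ∈₂ T → part x ≡ part y
    ∈₂-same-class T T-flat (inj₁ refl) (inj₁ refl) = refl
    ∈₂-same-class T T-flat (inj₁ refl) (inj₂ refl) = T-flat
    ∈₂-same-class T T-flat (inj₂ refl) (inj₁ refl) = ≡.sym T-flat
    ∈₂-same-class T T-flat (inj₂ refl) (inj₂ refl) = refl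

    same-class-token∈Aset : ∀ {E x y} T → part x ≡ part y → x ∈₂ T → y ∈₂ T → x ≢ y → Aset part E T ≡ true
    same-class-token∈Aset T x~y xT yT x≢y = ⌊⌋∨-introˡ (part (fst₂ T) ≟ part (snd₂ T)) (flat xT yT)
      where
      flat : _ ∈₂ T → _ ∈₂ T → part (fst₂ T) ≡ part (snd₂ T)
      flat (inj₁ refl) (inj₂ refl) = x~y
      flat (inj₂ refl) (inj₁ refl) = ≡.sym x~y
      flat (inj₁ refl) (inj₁ refl) = contradiction refl x≢y
      flat (inj₂ refl) (inj₂ refl) = contradiction refl x≢y

    φ-Ordered : Set
    φ-Ordered = ∀ i j → i < j → φ-empty G (Class part j) (Class part i)

    -- Condition (1) for a single token, so that Cond1 G part E unfolds to ∀ X → E X ≡ true → Isolated X.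
    Isolated : Token2 n → Set
    Isolated X = ∀ w → (part w ≡ part (fst₂ X) ⊎ part w ≡ part (snd₂ X)) →
      (Edge G (fst₂ X) w → w ≡ snd₂ X) × (Edge G (snd₂ X) w → w ≡ fst₂ X)

    Isolated∈ : Token2 n → Set
    Isolated∈ X = ∀ {x y w} → x ∈₂ X → y ∈₂ X → x ≢ y →
      (part w ≡ part x ⊎ part w ≡ part y) → Edge G x w → w ≡ y

    isolated⇒isolated∈ : ∀ {X} → Isolated X → Isolated∈ X
    isolated⇒isolated∈ iso (inj₁ refl) (inj₂ refl) _ w∈ = proj₁ (iso _ w∈)
    isolated⇒isolated∈ iso (inj₂ refl) (inj₁ refl) _ w∈ = proj₂ (iso _ (swap w∈))
    isolated⇒isolated∈ iso (inj₁ refl) (inj₁ refl) x≢y _ = contradiction refl x≢y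
    isolated⇒isolated∈ iso (inj₂ refl) (inj₂ refl) x≢y _ = contradiction refl x≢y

    isolated∈⇒isolated : ∀ {X} → Isolated∈ X → Isolated X
    isolated∈⇒isolated {a , b , a<b} iso w w∈ =
      iso (inj₁ refl) (inj₂ refl) (<⇒≢ a<b) w∈ , iso (inj₂ refl) (inj₁ refl) (≢-sym (<⇒≢ a<b)) (swap w∈)

    Aset-independent : ∀ {E} → Cond1 G part E → Cond2 G E → IndependentT2 G (Aset part E)
    Aset-independent cond1 cond2 X Y X∈ Y∈ (u , v , w , uX , vX , uY , wY , u≢v , u≢w , v≢w , vw)
      with ⌊⌋∨-elim (part (fst₂ X) ≟ part (snd₂ X)) X∈ | ⌊⌋∨-elim (part (fst₂ Y) ≟ part (snd₂ Y)) Y∈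
    ... | inj₁ X-flat | inj₁ Y-flat = same-class⇒nonadjacent
          (trans (≡.sym (∈₂-same-class X X-flat uX vX)) (∈₂-same-class Y Y-flat uY wY)) vw
    ... | inj₁ X-flat | inj₂ Y∈E = u≢v (≡.sym (isolated⇒isolated∈ {Y} (cond1 Y Y∈E) wY uY (≢-sym u≢w)
          (inj₂ (≡.sym (∈₂-same-class X X-flat uX vX))) (edge-sym vw)))
    ... | inj₂ X∈E | inj₁ Y-flat = u≢w (≡.sym (isolated⇒isolated∈ {X} (cond1 X X∈E) vX uX (≢-sym u≢v)
          (inj₂ (≡.sym (∈₂-same-class Y Y-flat uY wY))) vw))
    ... | inj₂ X∈E | inj₂ Y∈E = not-¬ vw (cond2 X Y u v w X∈E Y∈E uX vX uY wY u≢v u≢w v≢w)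

    module _ {E : TSet n} {S : TSet n} (S-ind : IndependentT2 G S) (A⊆S : Aset part E ⊆ₜ S)
             {X : Token2 n} (X∈S : S X ≡ true) where

      -- {x,c} ∈ A ⊆ S, and it would be adjacent to {x,y} ∈ S in T₂(G).
      no-foreign-neighbour : ∀ {x y c} → x ∈₂ X → y ∈₂ X → x ≢ y → c ≢ x → part c ≡ part x → ¬ Edge G y c
      no-foreign-neighbour {x} {y} {c} xX yX x≢y c≢x c~x yc with token (≢-sym c≢x)
      ... | T , xT , cT = S-ind X T X∈S (A⊆S T (same-class-token∈Aset {E} T (≡.sym c~x) xT cT (≢-sym c≢x)))
                            (x , y , c , xX , yX , xT , cT , x≢y , ≢-sym c≢x , edge⇒≢ yc , yc)

      φ-witness : ∀ {x y} → x ∈₂ X → y ∈₂ X → x ≢ y → adj G x y ≡ false →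
        φ G (Class part (part y)) (Class part (part x)) y
      φ-witness {x} {y} xX yX x≢y xy = ⌊⌋-complete (part y ≟ part y) refl ,
                                       insert-independent (classes-independent (part x)) y-nonadjacent
        where
        y-nonadjacent : ∀ v → Class part (part x) v ≡ true → adj G y v ≡ false
        y-nonadjacent v v∈ with v ≟ x
        ... | yes refl = nonedge-sym xy
        ... | no v≢x = ¬-not (no-foreign-neighbour xX yX x≢y v≢x (⌊⌋-sound (part v ≟ part x) v∈))

      cross-token-adjacent : φ-Ordered → part (fst₂ X) ≢ part (snd₂ X) → Edge G (fst₂ X) (snd₂ X)
      cross-token-adjacent φ-empties a≁b = ¬-not refute
        where
        a≢b : fst₂ X ≢ snd₂ X
        a≢b = a≁b ∘ cong part
        refute : adj G (fst₂ X) (snd₂ X) ≢ false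
        refute ab with <-cmp (part (fst₂ X)) (part (snd₂ X))
        ... | tri< a<b _ _ = φ-empties _ _ a<b _ (φ-witness (inj₁ refl) (inj₂ refl) a≢b ab)
        ... | tri≈ _ a~b _ = a≁b a~b
        ... | tri> _ _ b<a = φ-empties _ _ b<a _ (φ-witness (inj₂ refl) (inj₁ refl) (≢-sym a≢b) (nonedge-sym ab))

      ∈S⇒isolated : Isolated X
      ∈S⇒isolated = isolated∈⇒isolated {X} sole-neighbour
        where
        sole-neighbour : Isolated∈ X
        sole-neighbour xX yX x≢y (inj₁ w~x) xw = contradiction xw (same-class⇒nonadjacent (≡.sym w~x))
        sole-neighbour {y = y} {w} xX yX x≢y (inj₂ w~y) xw with w ≟ y
        ... | yes w≡y = w≡y
        ... | no w≢y = contradiction xw (no-foreign-neighbour yX xX (≢-sym x≢y) w≢y w~y)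

      insertₜ-admissible : Admissible G part E → Edge G (fst₂ X) (snd₂ X) → Admissible G part (insertₜ X E)
      insertₜ-admissible (E-edges , cond1 , _) ab =
        insertₜ-all (λ Y → Edge G (fst₂ Y) (snd₂ Y)) ab E-edges ,
        insertₜ-all Isolated ∈S⇒isolated cond1 ,
        independentT2⇒cond2 (independentT2-⊆ S-ind (insertₜ-all (λ Y → S Y ≡ true) X∈S E⊆S))
        where
        E⊆S : E ⊆ₜ S
        E⊆S Y Y∈E = A⊆S Y (⌊⌋∨-introʳ (part (fst₂ Y) ≟ part (snd₂ Y)) Y∈E)

      cross-token∈E : MaximalAdmissible G part E → φ-Ordered → part (fst₂ X) ≢ part (snd₂ X) → E X ≡ true
      cross-token∈E (E-admissible , E-maximal) φ-empties a≁b =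
        E-maximal (insertₜ X E) (insertₜ-admissible E-admissible (cross-token-adjacent φ-empties a≁b))
                  (λ Y → ⌊⌋∨-introʳ (Y ≟ₜ X)) X (⌊⌋∨-introˡ (X ≟ₜ X) refl)

      ∈S⇒∈Aset : MaximalAdmissible G part E → φ-Ordered → Aset part E X ≡ true
      ∈S⇒∈Aset E-maximal φ-empties with part (fst₂ X) ≟ part (snd₂ X)
      ... | yes _ = refl
      ... | no a≁b = cross-token∈E E-maximal φ-empties a≁b

theorem3p11 : ∀ {n k} (G : Graph n) (part : Fin n → Fin k) (E : TSet n) →
    GoodPartition G part → MaximalAdmissible G part E →
    MaximalIndependentT2 G (Aset part E)
theorem3p11 G part E (_ , classes-independent , φ-empties) E-maximal@((_ , cond1 , cond2) , _) =
  Aset-independent G part classes-independent cond1 cond2 ,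
  λ S S-ind A⊆S X X∈S → ∈S⇒∈Aset G part classes-independent S-ind A⊆S X∈S E-maximal φ-empties
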